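{- For $m\geq 2$ and $1\leq i\leq m-1$, $$\frac{d_i(m)^2}{d_{i-1}(m)d_{i+1}(m)}>\frac{i+1}{i};$$ equivalently, the sequence $\{i!\,d_i(m)\}_{0\le i\le m}$ is log-concave.
   Context: For integers $m\geq 0$, the Boros-Moll polynomial is $P_m(a)=2^{ -2m}\sum_{k}2^k\binom{2m-2k}{m-k}\binom{m+k}{k}(a+1)^k=\sum_{i=0}^m d_i(m)a^i$, so that $d_i(m)=2^{ -2m}\sum_{k=0}^m 2^k\binom{2m-2k}{m-k}\binom{m+k}{m}\binom{k}{i}$ for $0\le i\le m$. These coefficients are positive. A sequence $\{a_k\}$ is log-concave if $a_k^2\geq a_{k-1}a_{k+1}$ for all interior indices $k$. -}

module Defs where

open import Data.Nat as ℕ using (ℕ; zero; suc; _+_; _*_; _^_)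
open import Data.Nat.Combinatorics using (_C_)
open import Data.Integer using (+_)
open import Data.Rational as ℚ using (ℚ; _/_)
import Data.Nat.Properties as NP

sumTo : ℕ → (ℕ → ℕ) → ℕ
sumTo zero    f = f 0
sumTo (suc n) f = sumTo n f + f (suc n)

dNum : ℕ → ℕ → ℕ
dNum i m = sumTo m (λ k → 2 ^ k * ((2 * m ℕ.∸ 2 * k) C (m ℕ.∸ k)) * ((m + k) C m) * (k C i))

d : ℕ → ℕ → ℚ
d i m = _/_ (+ dNum i m) (2 ^ (2 * m)) {{ℕ.>-nonZero (NP.m^n>0 2 (2 * m))}}

module Submission where

-- Write D_i(m) = 4^m d_i(m) = Σ_k t(m,k) C(k,i) with t(m,k) = 2^k C(2m-2k,m-k) C(m+k,m).
-- 1. Binomial: absorption, symmetry and the contiguous relations of C(2j,j), C(a+k,a).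
-- 2. Recurrence: the weights t(m,k) satisfy three linear relations in m; summing them
--    against C(k,i) (summation by parts) gives the recurrence
--      (m+1) D_{i+1}(m+1) = 4(m+i+1) D_i(m) + (8m+4i+10) D_{i+1}(m).
-- 3. LogConcavity: for x_{j+1}(m) = j! D_j(m) this reads
--      (m+1) x_{j+1}(m+1) = 4j(m+j) x_j(m) + 2(4m+2j+3) x_{j+1}(m),
--    and a polynomial identity plus AM-GM shows that such a step maps a positive
--    log-concave sequence to a strictly log-concave one.
-- 4. ScaledSequence: induction on m makes every x(m) log-concave, hence strictly so;
--    RationalTransfer moves the resulting inequality of numerators to the rationals d_i(m).

open import Defs

module Binomial where

  open import Data.Nat using (ℕ; zero; suc; _+_; _*_; _∸_; s≤s; z≤n)
  open import Data.Nat.Properties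
  open import Data.Nat.Combinatorics
    using (_C_; nCk+nC[k+1]≡[n+1]C[k+1]; nCk≡nC[n∸k]; nC1≡n; nCn≡1; k>n⇒nCk≡0)
  open import Relation.Binary.PropositionalEquality
  open import Data.Nat.Tactic.RingSolver using (solve-∀)
  open ≡-Reasoning

  pascal : ∀ n k → suc n C suc k ≡ n C k + n C suc k
  pascal n k = sym (nCk+nC[k+1]≡[n+1]C[k+1] n k)

  absorption : ∀ n k → suc k * (suc n C suc k) ≡ suc n * (n C k)
  absorption n zero = begin
    1 * (suc n C 1)  ≡⟨ *-identityˡ _ ⟩
    suc n C 1        ≡⟨ nC1≡n (suc n) ⟩
    suc n            ≡⟨ *-identityʳ (suc n) ⟨
    suc n * 1        ∎
  absorption zero (suc k) = begin
    suc (suc k) * (1 C suc (suc k))  ≡⟨ cong (suc (suc k) *_) (k>n⇒nCk≡0 {1} {suc (suc k)} (s≤s (s≤s z≤n))) ⟩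
    suc (suc k) * 0                  ≡⟨ *-zeroʳ (suc (suc k)) ⟩
    0                                ≡⟨ cong (1 *_) (k>n⇒nCk≡0 {0} {suc k} (s≤s z≤n)) ⟨
    1 * (0 C suc k)                  ∎
  absorption (suc n) (suc k) = begin
    suc (suc k) * (suc (suc n) C suc (suc k))
      ≡⟨ cong (suc (suc k) *_) (pascal (suc n) (suc k)) ⟩
    suc (suc k) * (suc n C suc k + suc n C suc (suc k))
      ≡⟨ regroup (suc n C suc k) (suc n C suc (suc k)) k ⟩
    suc n C suc k + (suc k * (suc n C suc k) + suc (suc k) * (suc n C suc (suc k)))
      ≡⟨ cong₂ (λ a b → suc n C suc k + (a + b)) (absorption n k) (absorption n (suc k)) ⟩
    suc n C suc k + (suc n * (n C k) + suc n * (n C suc k))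
      ≡⟨ cong (λ a → a + (suc n * (n C k) + suc n * (n C suc k))) (pascal n k) ⟩
    (n C k + n C suc k) + (suc n * (n C k) + suc n * (n C suc k))
      ≡⟨ collect (n C k) (n C suc k) n ⟩
    suc (suc n) * (n C k + n C suc k)
      ≡⟨ cong (suc (suc n) *_) (pascal n k) ⟨
    suc (suc n) * (suc n C suc k) ∎
    where
    regroup : ∀ x y k → suc (suc k) * (x + y) ≡ x + (suc k * x + suc (suc k) * y)
    regroup = solve-∀
    collect : ∀ x y n → (x + y) + (suc n * x + suc n * y) ≡ suc (suc n) * (x + y)
    collect = solve-∀

  symmetry : ∀ a b → (a + b) C a ≡ (a + b) C b
  symmetry a b = begin
    (a + b) C a              ≡⟨ nCk≡nC[n∸k] (m≤m+n a b) ⟩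
    (a + b) C (a + b ∸ a)    ≡⟨ cong ((a + b) C_) (m+n∸m≡n a b) ⟩
    (a + b) C b              ∎

  -- (i+1) C(k,i+1) + i C(k,i) = k C(k,i): the identity that turns the weight C(k+1,i+1)
  -- back into the weights C(k,i), C(k,i+1) in the recurrence for d_i(m).
  shift : ∀ k i → suc i * (k C suc i) + i * (k C i) ≡ k * (k C i)
  shift k i = +-cancelˡ-≡ (k C i) _ _ (begin
    k C i + (suc i * (k C suc i) + i * (k C i))  ≡⟨ regroup (k C i) (k C suc i) i ⟩
    suc i * (k C i + k C suc i)                  ≡⟨ cong (suc i *_) (pascal k i) ⟨
    suc i * (suc k C suc i)                      ≡⟨ absorption k i ⟩
    suc k * (k C i)                              ∎)
    where
    regroup : ∀ x y i → x + (suc i * y + i * x) ≡ suc i * (x + y)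
    regroup = solve-∀

  central : ℕ → ℕ
  central j = (j + j) C j

  central-rec : ∀ j → suc j * central (suc j) ≡ (4 * j + 2) * central j
  central-rec j = *-cancelˡ-≡ _ _ (suc j) (begin
    suc j * (suc j * ((suc j + suc j) C suc j))
      ≡⟨ cong (λ n → suc j * (suc j * (n C suc j))) double-suc ⟩
    suc j * (suc j * (suc (suc (j + j)) C suc j))
      ≡⟨ cong (suc j *_) (absorption (suc (j + j)) j) ⟩
    suc j * (suc (suc (j + j)) * (suc (j + j) C j))
      ≡⟨ cong (λ c → suc j * (suc (suc (j + j)) * c)) middle-symmetry ⟩
    suc j * (suc (suc (j + j)) * (suc (j + j) C suc j))
      ≡⟨ swap j (suc (j + j) C suc j) ⟩
    suc (suc (j + j)) * (suc j * (suc (j + j) C suc j))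
      ≡⟨ cong (suc (suc (j + j)) *_) (absorption (j + j) j) ⟩
    suc (suc (j + j)) * (suc (j + j) * central j)
      ≡⟨ collect j (central j) ⟩
    suc j * ((4 * j + 2) * central j) ∎)
    where
    double-suc : suc j + suc j ≡ suc (suc (j + j))
    double-suc = cong suc (+-suc j j)
    middle-symmetry : suc (j + j) C j ≡ suc (j + j) C suc j
    middle-symmetry = begin
      suc (j + j) C j      ≡⟨ cong (_C j) (+-suc j j) ⟨
      (j + suc j) C j      ≡⟨ symmetry j (suc j) ⟩
      (j + suc j) C suc j  ≡⟨ cong (_C suc j) (+-suc j j) ⟩
      suc (j + j) C suc j  ∎
    swap : ∀ j x → suc j * (suc (suc (j + j)) * x) ≡ suc (suc (j + j)) * (suc j * x)
    swap = solve-∀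
    collect : ∀ j x → suc (suc (j + j)) * (suc (j + j) * x) ≡ suc j * ((4 * j + 2) * x)
    collect = solve-∀

  mixed : ℕ → ℕ → ℕ
  mixed a k = (a + k) C a

  mixed-up : ∀ a k → suc a * mixed (suc a) k ≡ suc (a + k) * mixed a k
  mixed-up a k = absorption (a + k) a

  mixed-right : ∀ a k → suc k * mixed a (suc k) ≡ suc (a + k) * mixed a k
  mixed-right a k = begin
    suc k * ((a + suc k) C a)       ≡⟨ cong (suc k *_) (symmetry a (suc k)) ⟩
    suc k * ((a + suc k) C suc k)   ≡⟨ cong (λ n → suc k * (n C suc k)) (+-suc a k) ⟩
    suc k * (suc (a + k) C suc k)   ≡⟨ absorption (a + k) k ⟩
    suc (a + k) * ((a + k) C k)     ≡⟨ cong (suc (a + k) *_) (symmetry a k) ⟨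
    suc (a + k) * mixed a k         ∎

  mixed-zero : ∀ a → mixed a 0 ≡ 1
  mixed-zero a = trans (cong (_C a) (+-identityʳ a)) (nCn≡1 a)

module FiniteSums where

  open import Data.Nat using (ℕ; zero; suc; _+_; _*_; _≤_; z≤n)
  open import Data.Nat.Properties
  open import Relation.Binary.PropositionalEquality
  open import Data.Nat.Tactic.RingSolver using (solve-∀)
  open ≡-Reasoning

  sumTo-cong : ∀ n {f g : ℕ → ℕ} → (∀ k → k ≤ n → f k ≡ g k) → sumTo n f ≡ sumTo n g
  sumTo-cong zero    f≗g = f≗g 0 z≤n
  sumTo-cong (suc n) f≗g =
    cong₂ _+_ (sumTo-cong n (λ k k≤n → f≗g k (m≤n⇒m≤1+n k≤n))) (f≗g (suc n) ≤-refl)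

  sumTo-+ : ∀ n (f g : ℕ → ℕ) → sumTo n (λ k → f k + g k) ≡ sumTo n f + sumTo n g
  sumTo-+ zero    f g = refl
  sumTo-+ (suc n) f g = begin
    sumTo n (λ k → f k + g k) + (f (suc n) + g (suc n))
      ≡⟨ cong (_+ (f (suc n) + g (suc n))) (sumTo-+ n f g) ⟩
    sumTo n f + sumTo n g + (f (suc n) + g (suc n))
      ≡⟨ interchange (sumTo n f) (sumTo n g) (f (suc n)) (g (suc n)) ⟩
    sumTo n f + f (suc n) + (sumTo n g + g (suc n)) ∎
    where
    interchange : ∀ a b c d → a + b + (c + d) ≡ a + c + (b + d)
    interchange = solve-∀

  sumTo-* : ∀ n c (f : ℕ → ℕ) → sumTo n (λ k → c * f k) ≡ c * sumTo n f
  sumTo-* zero    c f = refl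
  sumTo-* (suc n) c f = begin
    sumTo n (λ k → c * f k) + c * f (suc n)  ≡⟨ cong (_+ c * f (suc n)) (sumTo-* n c f) ⟩
    c * sumTo n f + c * f (suc n)            ≡⟨ *-distribˡ-+ c (sumTo n f) (f (suc n)) ⟨
    c * (sumTo n f + f (suc n))              ∎

  telescope : ∀ m (a b g h : ℕ → ℕ) →
    a 0 + b 0 ≡ h 0 →
    (∀ k → suc k ≤ m → a (suc k) + b (suc k) ≡ g k + h (suc k)) →
    a (suc m) ≡ g m →
    sumTo (suc m) a + sumTo m b ≡ sumTo m g + sumTo m h
  telescope m a b g h first middle last = begin
    sumTo m a + a (suc m) + sumTo m b  ≡⟨ cong (λ x → sumTo m a + x + sumTo m b) last ⟩
    sumTo m a + g m + sumTo m b        ≡⟨ swap (sumTo m a) (g m) (sumTo m b) ⟩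
    sumTo m a + sumTo m b + g m        ≡⟨ partial m ≤-refl ⟩
    sumTo m g + sumTo m h              ∎
    where
    swap : ∀ x y z → x + y + z ≡ x + z + y
    swap = solve-∀
    partial : ∀ n → n ≤ m → sumTo n a + sumTo n b + g n ≡ sumTo n g + sumTo n h
    partial zero    _ = begin
      a 0 + b 0 + g 0  ≡⟨ cong (_+ g 0) first ⟩
      h 0 + g 0        ≡⟨ +-comm (h 0) (g 0) ⟩
      g 0 + h 0        ∎
    partial (suc n) n<m = begin
      sumTo n a + a (suc n) + (sumTo n b + b (suc n)) + g (suc n)
        ≡⟨ split (sumTo n a) (a (suc n)) (sumTo n b) (b (suc n)) (g (suc n)) ⟩
      (sumTo n a + sumTo n b) + (a (suc n) + b (suc n)) + g (suc n)
        ≡⟨ cong (λ x → (sumTo n a + sumTo n b) + x + g (suc n)) (middle n n<m) ⟩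
      (sumTo n a + sumTo n b) + (g n + h (suc n)) + g (suc n)
        ≡⟨ split′ (sumTo n a + sumTo n b) (g n) (h (suc n)) (g (suc n)) ⟩
      (sumTo n a + sumTo n b + g n) + h (suc n) + g (suc n)
        ≡⟨ cong (λ x → x + h (suc n) + g (suc n)) (partial n (<⇒≤ n<m)) ⟩
      (sumTo n g + sumTo n h) + h (suc n) + g (suc n)
        ≡⟨ merge (sumTo n g) (sumTo n h) (h (suc n)) (g (suc n)) ⟩
      (sumTo n g + g (suc n)) + (sumTo n h + h (suc n)) ∎
      where
      split : ∀ sa x sb y z → sa + x + (sb + y) + z ≡ (sa + sb) + (x + y) + z
      split = solve-∀
      split′ : ∀ s x y z → s + (x + y) + z ≡ s + x + y + z
      split′ = solve-∀
      merge : ∀ sg sh y z → sg + sh + y + z ≡ (sg + z) + (sh + y)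
      merge = solve-∀

module Recurrence where

  open import Data.Nat using (ℕ; suc; _+_; _*_; _∸_; _^_; _≤_)
  open import Data.Nat.Properties
  open import Data.Nat.Combinatorics using (_C_)
  open import Relation.Binary.PropositionalEquality
  open import Data.Nat.Tactic.RingSolver using (solve-∀)
  open Binomial
  open FiniteSums
  open ≡-Reasoning

  weight : ℕ → ℕ → ℕ
  weight m k = 2 ^ k * central (m ∸ k) * mixed m k

  -- D i m = Σ_{k ≤ m} t(m,k) C(k,i), which is 4^m d_i(m).
  D : ℕ → ℕ → ℕ
  D i m = sumTo m (λ k → weight m k * (k C i))

  -- The three recurrences in m satisfied by the weights: at the two ends of the range
  -- and, in the middle, a four-term relation (the creative-telescoping certificate).
  weight-first : ∀ m → suc m * weight (suc m) 0 ≡ (4 * m + 2) * weight m 0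
  weight-first m = begin
    suc m * weight (suc m) 0          ≡⟨ cong (suc m *_) (weight-zero (suc m)) ⟩
    suc m * central (suc m)           ≡⟨ central-rec m ⟩
    (4 * m + 2) * central m           ≡⟨ cong ((4 * m + 2) *_) (weight-zero m) ⟨
    (4 * m + 2) * weight m 0          ∎
    where
    weight-zero : ∀ n → weight n 0 ≡ central n
    weight-zero n = trans (cong (1 * central n *_) (mixed-zero n))
                          (trans (*-identityʳ _) (*-identityˡ _))

  weight-last : ∀ m → suc m * weight (suc m) (suc m) ≡ 4 * (m + m + 1) * weight m m
  weight-last m rewrite n∸n≡0 m = begin
    suc m * (2 * 2 ^ m * 1 * central (suc m))  ≡⟨ reorder m (2 ^ m) (central (suc m)) ⟩
    2 * 2 ^ m * (suc m * central (suc m))      ≡⟨ cong (2 * 2 ^ m *_) (central-rec m) ⟩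
    2 * 2 ^ m * ((4 * m + 2) * central m)      ≡⟨ collect m (2 ^ m) (central m) ⟩
    4 * (m + m + 1) * (2 ^ m * 1 * central m)  ∎
    where
    reorder : ∀ m p x → suc m * (2 * p * 1 * x) ≡ 2 * p * (suc m * x)
    reorder = solve-∀
    collect : ∀ m p x → 2 * p * ((4 * m + 2) * x) ≡ 4 * (m + m + 1) * (p * 1 * x)
    collect = solve-∀

  -- The middle relation reduces, after naming the factors of the weights, to the three
  -- contiguous relations of central and mixed binomial coefficients (here m = j + k + 1).
  middle-algebra : ∀ j k P U w R Q S →
    suc (suc (j + k)) * R ≡ suc (suc (j + k) + suc k) * Q →
    suc k * Q ≡ suc (suc (j + k) + k) * S →
    suc j * U ≡ (4 * j + 2) * w →
    suc (suc (j + k)) * (2 * P * U * R) + 4 * suc k * (2 * P * w * Q)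
      ≡ 4 * (suc (j + k) + k + 1) * (P * U * S) + (4 * suc (j + k) + 2) * (2 * P * w * Q)
  middle-algebra j k P U w R Q S up right cen = begin
    suc (suc (j + k)) * (2 * P * U * R) + 4 * suc k * (2 * P * w * Q)
      ≡⟨ step₁ j k P U w R Q ⟩
    2 * P * U * (suc (suc (j + k)) * R) + 8 * suc k * P * w * Q
      ≡⟨ cong (λ x → 2 * P * U * x + 8 * suc k * P * w * Q) up ⟩
    2 * P * U * (suc (suc (j + k) + suc k) * Q) + 8 * suc k * P * w * Q
      ≡⟨ step₂ j k P U w Q ⟩
    2 * P * Q * (suc j * U) + 4 * P * U * (suc k * Q) + 8 * suc k * P * w * Q
      ≡⟨ cong₂ (λ x y → 2 * P * Q * x + 4 * P * U * y + 8 * suc k * P * w * Q) cen right ⟩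
    2 * P * Q * ((4 * j + 2) * w) + 4 * P * U * (suc (suc (j + k) + k) * S) + 8 * suc k * P * w * Q
      ≡⟨ step₃ j k P U w Q S ⟩
    4 * (suc (j + k) + k + 1) * (P * U * S) + (4 * suc (j + k) + 2) * (2 * P * w * Q) ∎
    where
    step₁ : ∀ j k P U w R Q →
      suc (suc (j + k)) * (2 * P * U * R) + 4 * suc k * (2 * P * w * Q)
        ≡ 2 * P * U * (suc (suc (j + k)) * R) + 8 * suc k * P * w * Q
    step₁ = solve-∀
    step₂ : ∀ j k P U w Q →
      2 * P * U * (suc (suc (j + k) + suc k) * Q) + 8 * suc k * P * w * Q
        ≡ 2 * P * Q * (suc j * U) + 4 * P * U * (suc k * Q) + 8 * suc k * P * w * Q
    step₂ = solve-∀
    step₃ : ∀ j k P U w Q S →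
      2 * P * Q * ((4 * j + 2) * w) + 4 * P * U * (suc (suc (j + k) + k) * S) + 8 * suc k * P * w * Q
        ≡ 4 * (suc (j + k) + k + 1) * (P * U * S) + (4 * suc (j + k) + 2) * (2 * P * w * Q)
    step₃ = solve-∀

  MiddleRelation : ℕ → ℕ → Set
  MiddleRelation m k = suc m * weight (suc m) (suc k) + 4 * suc k * weight m (suc k)
                       ≡ 4 * (m + k + 1) * weight m k + (4 * m + 2) * weight m (suc k)

  weight-middle : ∀ m k → suc k ≤ m → MiddleRelation m k
  weight-middle m k k<m = subst (λ n → MiddleRelation n k) m≡j+k+1 (at (m ∸ suc k))
    where
    m≡j+k+1 : suc (m ∸ suc k + k) ≡ m
    m≡j+k+1 = trans (sym (+-suc (m ∸ suc k) k)) (m∸n+n≡m k<m)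
    -- with j = m - k - 1, the factors C(2(m-k), m-k) become central (suc j) and central j
    at : ∀ j → MiddleRelation (suc (j + k)) k
    at j rewrite m+n∸n≡m (suc j) k | m+n∸n≡m j k =
      middle-algebra j k (2 ^ k) (central (suc j)) (central j) _ _ _
        (mixed-up (suc (j + k)) (suc k)) (mixed-right (suc (j + k)) k) (central-rec j)

  weighted-sum-rec : ∀ m (f : ℕ → ℕ) →
    sumTo (suc m) (λ k → suc m * (weight (suc m) k * f k))
      + sumTo m (λ k → 4 * k * (weight m k * f k))
    ≡ sumTo m (λ k → 4 * (m + k + 1) * (weight m k * f (suc k)))
      + sumTo m (λ k → (4 * m + 2) * (weight m k * f k))
  weighted-sum-rec m f = telescope m _ _ _ _ first middle last
    where
    distrib : ∀ A x B y F → (A * x + B * y) * F ≡ A * (x * F) + B * (y * F)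
    distrib = solve-∀
    first : suc m * (weight (suc m) 0 * f 0) + 4 * 0 * (weight m 0 * f 0)
              ≡ (4 * m + 2) * (weight m 0 * f 0)
    first = begin
      suc m * (weight (suc m) 0 * f 0) + 4 * 0 * (weight m 0 * f 0)
        ≡⟨ distrib (suc m) (weight (suc m) 0) (4 * 0) (weight m 0) (f 0) ⟨
      (suc m * weight (suc m) 0 + 0) * f 0
        ≡⟨ cong (_* f 0) (trans (+-identityʳ _) (weight-first m)) ⟩
      (4 * m + 2) * weight m 0 * f 0
        ≡⟨ *-assoc (4 * m + 2) (weight m 0) (f 0) ⟩
      (4 * m + 2) * (weight m 0 * f 0) ∎
    middle : ∀ k → suc k ≤ m →
      suc m * (weight (suc m) (suc k) * f (suc k)) + 4 * suc k * (weight m (suc k) * f (suc k))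
        ≡ 4 * (m + k + 1) * (weight m k * f (suc k)) + (4 * m + 2) * (weight m (suc k) * f (suc k))
    middle k k<m = begin
      suc m * (weight (suc m) (suc k) * f (suc k)) + 4 * suc k * (weight m (suc k) * f (suc k))
        ≡⟨ distrib (suc m) (weight (suc m) (suc k)) (4 * suc k) (weight m (suc k)) (f (suc k)) ⟨
      (suc m * weight (suc m) (suc k) + 4 * suc k * weight m (suc k)) * f (suc k)
        ≡⟨ cong (_* f (suc k)) (weight-middle m k k<m) ⟩
      (4 * (m + k + 1) * weight m k + (4 * m + 2) * weight m (suc k)) * f (suc k)
        ≡⟨ distrib (4 * (m + k + 1)) (weight m k) (4 * m + 2) (weight m (suc k)) (f (suc k)) ⟩
      4 * (m + k + 1) * (weight m k * f (suc k)) + (4 * m + 2) * (weight m (suc k) * f (suc k)) ∎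
    last : suc m * (weight (suc m) (suc m) * f (suc m)) ≡ 4 * (m + m + 1) * (weight m m * f (suc m))
    last = begin
      suc m * (weight (suc m) (suc m) * f (suc m))  ≡⟨ *-assoc (suc m) (weight (suc m) (suc m)) (f (suc m)) ⟨
      suc m * weight (suc m) (suc m) * f (suc m)    ≡⟨ cong (_* f (suc m)) (weight-last m) ⟩
      4 * (m + m + 1) * weight m m * f (suc m)      ≡⟨ *-assoc (4 * (m + m + 1)) (weight m m) (f (suc m)) ⟩
      4 * (m + m + 1) * (weight m m * f (suc m))    ∎

  sum-recurrence : ∀ m (f : ℕ → ℕ) A B (X Y : ℕ → ℕ) →
    (∀ k → k ≤ m → 4 * (m + k + 1) * (weight m k * f (suc k)) + (4 * m + 2) * (weight m k * f k)
                   ≡ A * X k + B * Y k + 4 * k * (weight m k * f k)) →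
    suc m * sumTo (suc m) (λ k → weight (suc m) k * f k) ≡ A * sumTo m X + B * sumTo m Y
  sum-recurrence m f A B X Y pointwise = +-cancelʳ-≡ correction _ _ (begin
    suc m * sumTo (suc m) (λ k → weight (suc m) k * f k) + correction
      ≡⟨ cong (_+ correction) (sumTo-* (suc m) (suc m) (λ k → weight (suc m) k * f k)) ⟨
    sumTo (suc m) (λ k → suc m * (weight (suc m) k * f k)) + correction
      ≡⟨ weighted-sum-rec m f ⟩
    sumTo m G + sumTo m H
      ≡⟨ sumTo-+ m G H ⟨
    sumTo m (λ k → G k + H k)
      ≡⟨ sumTo-cong m pointwise ⟩
    sumTo m (λ k → A * X k + B * Y k + 4 * k * (weight m k * f k))
      ≡⟨ sumTo-+ m (λ k → A * X k + B * Y k) (λ k → 4 * k * (weight m k * f k)) ⟩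
    sumTo m (λ k → A * X k + B * Y k) + correction
      ≡⟨ cong (_+ correction) (sumTo-+ m (λ k → A * X k) (λ k → B * Y k)) ⟩
    sumTo m (λ k → A * X k) + sumTo m (λ k → B * Y k) + correction
      ≡⟨ cong₂ (λ x y → x + y + correction) (sumTo-* m A X) (sumTo-* m B Y) ⟩
    A * sumTo m X + B * sumTo m Y + correction ∎)
    where
    correction : ℕ
    correction = sumTo m (λ k → 4 * k * (weight m k * f k))
    G H : ℕ → ℕ
    G k = 4 * (m + k + 1) * (weight m k * f (suc k))
    H k = (4 * m + 2) * (weight m k * f k)

  D-rec-zero : ∀ m → suc m * D 0 (suc m) ≡ (8 * m + 6) * D 0 m
  D-rec-zero m = sum-recurrence m (_C 0) 0 (8 * m + 6) (λ _ → 0) (λ k → weight m k * (k C 0))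
    (λ k _ → pointwise m k (weight m k))
    where
    pointwise : ∀ m k t → 4 * (m + k + 1) * (t * 1) + (4 * m + 2) * (t * 1)
                          ≡ 0 * 0 + (8 * m + 6) * (t * 1) + 4 * k * (t * 1)
    pointwise = solve-∀

  D-rec : ∀ m i → suc m * D (suc i) (suc m) ≡ 4 * (m + i + 1) * D i m + (8 * m + 4 * i + 10) * D (suc i) m
  D-rec m i = sum-recurrence m (_C suc i) (4 * (m + i + 1)) (8 * m + 4 * i + 10)
    (λ k → weight m k * (k C i)) (λ k → weight m k * (k C suc i)) pointwise
    where
    -- after Pascal's rule C(k+1,i+1) = x + y, the shift identity trades k x for (i+1) y + i x
    algebra : ∀ k t x y → suc i * y + i * x ≡ k * x →
      4 * (m + k + 1) * (t * (x + y)) + (4 * m + 2) * (t * y)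
        ≡ 4 * (m + i + 1) * (t * x) + (8 * m + 4 * i + 10) * (t * y) + 4 * k * (t * y)
    algebra k t x y shifted = begin
      4 * (m + k + 1) * (t * (x + y)) + (4 * m + 2) * (t * y)
        ≡⟨ expand m k t x y ⟩
      4 * (m + 1) * t * x + 4 * t * (k * x) + (8 * m + 4 * k + 6) * t * y
        ≡⟨ cong (λ z → 4 * (m + 1) * t * x + 4 * t * z + (8 * m + 4 * k + 6) * t * y) shifted ⟨
      4 * (m + 1) * t * x + 4 * t * (suc i * y + i * x) + (8 * m + 4 * k + 6) * t * y
        ≡⟨ collect m k i t x y ⟩
      4 * (m + i + 1) * (t * x) + (8 * m + 4 * i + 10) * (t * y) + 4 * k * (t * y) ∎
      where
      expand : ∀ m k t x y → 4 * (m + k + 1) * (t * (x + y)) + (4 * m + 2) * (t * y)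
                             ≡ 4 * (m + 1) * t * x + 4 * t * (k * x) + (8 * m + 4 * k + 6) * t * y
      expand = solve-∀
      collect : ∀ m k i t x y →
        4 * (m + 1) * t * x + 4 * t * (suc i * y + i * x) + (8 * m + 4 * k + 6) * t * y
          ≡ 4 * (m + i + 1) * (t * x) + (8 * m + 4 * i + 10) * (t * y) + 4 * k * (t * y)
      collect = solve-∀
    pointwise : ∀ k → k ≤ m →
      4 * (m + k + 1) * (weight m k * (suc k C suc i)) + (4 * m + 2) * (weight m k * (k C suc i))
        ≡ 4 * (m + i + 1) * (weight m k * (k C i)) + (8 * m + 4 * i + 10) * (weight m k * (k C suc i))
          + 4 * k * (weight m k * (k C suc i))
    pointwise k _ = begin
      4 * (m + k + 1) * (weight m k * (suc k C suc i)) + (4 * m + 2) * (weight m k * (k C suc i))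
        ≡⟨ cong (λ c → 4 * (m + k + 1) * (weight m k * c) + (4 * m + 2) * (weight m k * (k C suc i)))
                (pascal k i) ⟩
      4 * (m + k + 1) * (weight m k * (k C i + k C suc i)) + (4 * m + 2) * (weight m k * (k C suc i))
        ≡⟨ algebra k (weight m k) (k C i) (k C suc i) (shift k i) ⟩
      4 * (m + i + 1) * (weight m k * (k C i)) + (8 * m + 4 * i + 10) * (weight m k * (k C suc i))
        + 4 * k * (weight m k * (k C suc i)) ∎

  -- The numerator in Defs is exactly D: only 2m - 2k = (m - k) + (m - k) has to be observed.
  dNum≡D : ∀ i m → dNum i m ≡ D i m
  dNum≡D i m = sumTo-cong m (λ k _ →
    cong (λ n → 2 ^ k * (n C (m ∸ k)) * ((m + k) C m) * (k C i)) (double-difference k))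
    where
    double-difference : ∀ k → 2 * m ∸ 2 * k ≡ (m ∸ k) + (m ∸ k)
    double-difference k = trans (sym (*-distribˡ-∸ 2 m k)) (cong ((m ∸ k) +_) (+-identityʳ (m ∸ k)))

module LogConcavity where

  open import Data.Nat using (ℕ; zero; suc; _+_; _*_; _∸_; _≤_; _<_; z≤n; s≤s; >-nonZero)
  open import Data.Nat.Properties
  open import Data.Sum using (_⊎_; inj₁; inj₂)
  open import Relation.Nullary using (yes; no)
  open import Relation.Binary.PropositionalEquality
  open import Data.Nat.Tactic.RingSolver using (solve-∀)
  open ≤-Reasoning

  -- Coefficients of the recurrence (m+1) x_{j+1}(m+1) = α_j x_j(m) + β_j x_{j+1}(m)
  -- satisfied by x_{j+1}(m) = j! D_j(m).
  α β : ℕ → ℕ → ℕ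
  α m j = 4 * j * (m + j)
  β m j = 2 * (4 * m + 2 * j + 3)

  am-gm-ordered : ∀ x d → 2 * x * (x + d) ≤ x * x + (x + d) * (x + d)
  am-gm-ordered x d = subst (2 * x * (x + d) ≤_) (sym (square-gap x d)) (m≤m+n _ _)
    where
    square-gap : ∀ x d → x * x + (x + d) * (x + d) ≡ 2 * x * (x + d) + d * d
    square-gap = solve-∀

  am-gm : ∀ x y → 2 * x * y ≤ x * x + y * y
  am-gm x y with ≤-total x y
  ... | inj₁ x≤y = subst (λ z → 2 * x * z ≤ x * x + z * z) (m+[n∸m]≡n x≤y) (am-gm-ordered x (y ∸ x))
  ... | inj₂ y≤x = subst₂ _≤_ (swap y x) (+-comm (y * y) (x * x))
                     (subst (λ z → 2 * y * z ≤ y * y + z * z) (m+[n∸m]≡n y≤x) (am-gm-ordered y (x ∸ y)))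
    where
    swap : ∀ y x → 2 * y * x ≡ 2 * x * y
    swap = solve-∀

  product-bound : ∀ a₀ b₀ a₂ b₂ p q r t → p * r ≤ q * q → q * t ≤ r * r → p * t ≤ q * r →
    (a₀ * p + b₀ * q) * (a₂ * r + b₂ * t)
      ≤ a₀ * a₂ * (q * q) + (a₀ * b₂ + b₀ * a₂) * (q * r) + b₀ * b₂ * (r * r)
  product-bound a₀ b₀ a₂ b₂ p q r t pr≤qq qt≤rr pt≤qr = begin
    (a₀ * p + b₀ * q) * (a₂ * r + b₂ * t)
      ≡⟨ expand a₀ b₀ a₂ b₂ p q r t ⟩
    a₀ * a₂ * (p * r) + a₀ * b₂ * (p * t) + b₀ * a₂ * (q * r) + b₀ * b₂ * (q * t)
      ≤⟨ +-mono-≤ (+-mono-≤ (+-mono-≤ (*-monoʳ-≤ (a₀ * a₂) pr≤qq) (*-monoʳ-≤ (a₀ * b₂) pt≤qr)) ≤-refl)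
                  (*-monoʳ-≤ (b₀ * b₂) qt≤rr) ⟩
    a₀ * a₂ * (q * q) + a₀ * b₂ * (q * r) + b₀ * a₂ * (q * r) + b₀ * b₂ * (r * r)
      ≡⟨ collect a₀ b₀ a₂ b₂ q r ⟩
    a₀ * a₂ * (q * q) + (a₀ * b₂ + b₀ * a₂) * (q * r) + b₀ * b₂ * (r * r) ∎
    where
    expand : ∀ a₀ b₀ a₂ b₂ p q r t → (a₀ * p + b₀ * q) * (a₂ * r + b₂ * t)
      ≡ a₀ * a₂ * (p * r) + a₀ * b₂ * (p * t) + b₀ * a₂ * (q * r) + b₀ * b₂ * (q * t)
    expand = solve-∀
    collect : ∀ a₀ b₀ a₂ b₂ q r →
      a₀ * a₂ * (q * q) + a₀ * b₂ * (q * r) + b₀ * a₂ * (q * r) + b₀ * b₂ * (r * r)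
        ≡ a₀ * a₂ * (q * q) + (a₀ * b₂ + b₀ * a₂) * (q * r) + b₀ * b₂ * (r * r)
    collect = solve-∀

  -- The positive amount by which log-concavity is gained in one step (at index s, m = s + e).
  slack : ℕ → ℕ → ℕ
  slack s e = 4 * s * s + 8 * s + (4 * s + 1) * (4 * s + 4 * e + 3)

  -- The polynomial identity behind the step, with m = s + e:
  --   Y₂² − (quadratic bound on Y₁Y₃) = 4((2e+1)q − 2r)² + 4·slack·q²,
  -- written without subtraction.
  defect-identity : ∀ s e q r →
    (α (s + e) (suc s) * q + β (s + e) (suc s) * r) * (α (s + e) (suc s) * q + β (s + e) (suc s) * r)
      + 16 * (2 * e + 1) * (q * r)
    ≡ α (s + e) s * α (s + e) (2 + s) * (q * q)
      + (α (s + e) s * β (s + e) (2 + s) + β (s + e) s * α (s + e) (2 + s)) * (q * r)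
      + β (s + e) s * β (s + e) (2 + s) * (r * r)
      + 4 * ((2 * e + 1) * (2 * e + 1)) * (q * q) + 16 * (r * r) + 4 * slack s e * (q * q)
  defect-identity = unfolded
    where
    unfolded : ∀ s e q r →
      (4 * suc s * (s + e + suc s) * q + 2 * (4 * (s + e) + 2 * suc s + 3) * r)
        * (4 * suc s * (s + e + suc s) * q + 2 * (4 * (s + e) + 2 * suc s + 3) * r)
        + 16 * (2 * e + 1) * (q * r)
      ≡ 4 * s * (s + e + s) * (4 * (2 + s) * (s + e + (2 + s))) * (q * q)
        + (4 * s * (s + e + s) * (2 * (4 * (s + e) + 2 * (2 + s) + 3))
           + 2 * (4 * (s + e) + 2 * s + 3) * (4 * (2 + s) * (s + e + (2 + s)))) * (q * r)
        + 2 * (4 * (s + e) + 2 * s + 3) * (2 * (4 * (s + e) + 2 * (2 + s) + 3)) * (r * r)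
        + 4 * ((2 * e + 1) * (2 * e + 1)) * (q * q) + 16 * (r * r)
        + 4 * (4 * s * s + 8 * s + (4 * s + 1) * (4 * s + 4 * e + 3)) * (q * q)
    unfolded = solve-∀

  key-inequality : ∀ s e p q r t → p * r ≤ q * q → q * t ≤ r * r → p * t ≤ q * r →
    (α (s + e) s * p + β (s + e) s * q) * (α (s + e) (2 + s) * r + β (s + e) (2 + s) * t)
      + 4 * slack s e * (q * q)
    ≤ (α (s + e) (suc s) * q + β (s + e) (suc s) * r) * (α (s + e) (suc s) * q + β (s + e) (suc s) * r)
  key-inequality s e p q r t pr≤qq qt≤rr pt≤qr = begin
    Y₁ * Y₃ + extra  ≤⟨ +-monoˡ-≤ extra (product-bound a₀ b₀ a₂ b₂ p q r t pr≤qq qt≤rr pt≤qr) ⟩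
    bound + extra    ≤⟨ +-cancelˡ-≤ (16 * B * (q * r)) _ _ cancelled ⟩
    Y₂ * Y₂          ∎
    where
    m a₀ b₀ a₂ b₂ B Y₁ Y₂ Y₃ bound extra : ℕ
    m = s + e
    a₀ = α m s
    b₀ = β m s
    a₂ = α m (2 + s)
    b₂ = β m (2 + s)
    B = 2 * e + 1
    Y₁ = a₀ * p + b₀ * q
    Y₂ = α m (suc s) * q + β m (suc s) * r
    Y₃ = a₂ * r + b₂ * t
    bound = a₀ * a₂ * (q * q) + (a₀ * b₂ + b₀ * a₂) * (q * r) + b₀ * b₂ * (r * r)
    extra = 4 * slack s e * (q * q)
    mixed-term : 16 * B * (q * r) ≤ 4 * (B * B) * (q * q) + 16 * (r * r)
    mixed-term = subst₂ _≤_ (lhs B q r) (rhs B q r) (am-gm (2 * (B * q)) (4 * r))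
      where
      lhs : ∀ B q r → 2 * (2 * (B * q)) * (4 * r) ≡ 16 * B * (q * r)
      lhs = solve-∀
      rhs : ∀ B q r → 2 * (B * q) * (2 * (B * q)) + 4 * r * (4 * r) ≡ 4 * (B * B) * (q * q) + 16 * (r * r)
      rhs = solve-∀
    cancelled : 16 * B * (q * r) + (bound + extra) ≤ 16 * B * (q * r) + Y₂ * Y₂
    cancelled = begin
      16 * B * (q * r) + (bound + extra)
        ≤⟨ +-monoˡ-≤ (bound + extra) mixed-term ⟩
      4 * (B * B) * (q * q) + 16 * (r * r) + (bound + extra)
        ≡⟨ regroup (4 * (B * B) * (q * q)) (16 * (r * r)) bound extra ⟩
      bound + 4 * (B * B) * (q * q) + 16 * (r * r) + extra
        ≡⟨ defect-identity s e q r ⟨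
      Y₂ * Y₂ + 16 * B * (q * r)
        ≡⟨ +-comm (Y₂ * Y₂) (16 * B * (q * r)) ⟩
      16 * B * (q * r) + Y₂ * Y₂ ∎
      where
      regroup : ∀ x y u v → x + y + (u + v) ≡ u + x + y + v
      regroup = solve-∀

  record Admissible (m : ℕ) (x : ℕ → ℕ) : Set where
    field
      positive    : ∀ j → j ≤ m → 0 < x (suc j)
      vanishing   : ∀ j → suc m < j → x j ≡ 0
      log-concave : ∀ n → x n * x (2 + n) ≤ x (1 + n) * x (1 + n)

  positive-* : ∀ {a b} → 0 < a → 0 < b → 0 < a * b
  positive-* {suc a} {suc b} _ _ = s≤s z≤n

  positive-factor : ∀ c y → 0 < c * y → 0 < y
  positive-factor c zero    c*0>0 = subst (0 <_) (*-zeroʳ c) c*0>0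
  positive-factor c (suc y) _     = s≤s z≤n

  zero-factor : ∀ c y → suc c * y ≡ 0 → y ≡ 0
  zero-factor c zero    _  = refl
  zero-factor c (suc y) ()

  square-factor : ∀ c a b → (c * a) * (c * b) ≡ (c * c) * (a * b)
  square-factor = solve-∀

  slack-positive : ∀ s e → 0 < slack s e
  slack-positive s e = ≤-trans (positive-* (≤-trans (s≤s z≤n) (m≤n+m 1 (4 * s)))
                                           (≤-trans (s≤s z≤n) (m≤n+m 3 (4 * s + 4 * e))))
                               (m≤n+m _ (4 * s * s + 8 * s))

  β-positive : ∀ m j → 0 < β m j
  β-positive m j = positive-* {2} (s≤s z≤n) (≤-trans (s≤s z≤n) (m≤n+m 3 (4 * m + 2 * j)))

  α-positive : ∀ m → 0 < α m (suc m)
  α-positive m = positive-* (positive-* {4} {suc m} (s≤s z≤n) (s≤s z≤n)) (≤-trans (s≤s z≤n) (m≤n+m (suc m) m))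

  module Step (m : ℕ) (x x′ : ℕ → ℕ)
    (recurrence : ∀ j → suc m * x′ (suc j) ≡ α m j * x j + β m j * x (suc j))
    (x′-zero : x′ 0 ≡ 0)
    (adm : Admissible m x) where

    open Admissible adm

    -- Log-concavity across a gap of two, x_n x_{n+3} ≤ x_{n+1} x_{n+2}, on the positive range
    -- obtained by multiplying two log-concavity inequalities; beyond it x_{n+3} vanishes.
    log-concave-gap : ∀ n → x n * x (3 + n) ≤ x (1 + n) * x (2 + n)
    log-concave-gap n with n <? m
    ... | yes n<m = *-cancelʳ-≤ _ _ (x (1 + n) * x (2 + n))
            {{>-nonZero (positive-* (positive n (<⇒≤ n<m)) (positive (suc n) n<m))}} (begin
        x n * x (3 + n) * (x (1 + n) * x (2 + n))
          ≡⟨ pair-up (x n) (x (1 + n)) (x (2 + n)) (x (3 + n)) ⟩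
        (x n * x (2 + n)) * (x (1 + n) * x (3 + n))
          ≤⟨ *-mono-≤ (log-concave n) (log-concave (suc n)) ⟩
        (x (1 + n) * x (1 + n)) * (x (2 + n) * x (2 + n))
          ≡⟨ regroup (x (1 + n)) (x (2 + n)) ⟩
        x (1 + n) * x (2 + n) * (x (1 + n) * x (2 + n)) ∎)
      where
      pair-up : ∀ p q r t → p * t * (q * r) ≡ (p * r) * (q * t)
      pair-up = solve-∀
      regroup : ∀ q r → (q * q) * (r * r) ≡ q * r * (q * r)
      regroup = solve-∀
    ... | no n≮m = subst (_≤ x (1 + n) * x (2 + n)) (sym x₀x₃≡0) z≤n
      where
      x₀x₃≡0 : x n * x (3 + n) ≡ 0
      x₀x₃≡0 = trans (cong (x n *_) (vanishing (3 + n) (s≤s (s≤s (m≤n⇒m≤1+n (≮⇒≥ n≮m))))))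
                     (*-zeroʳ (x n))

    positive′ : ∀ j → j ≤ suc m → 0 < x′ (suc j)
    positive′ j j≤1+m = positive-factor (suc m) (x′ (suc j))
      (subst (0 <_) (sym (recurrence j)) (right-hand-side (m≤n⇒m<n∨m≡n j≤1+m)))
      where
      right-hand-side : j < suc m ⊎ j ≡ suc m → 0 < α m j * x j + β m j * x (suc j)
      right-hand-side (inj₁ (s≤s j≤m)) =
        ≤-trans (positive-* (β-positive m j) (positive j j≤m)) (m≤n+m _ _)
      right-hand-side (inj₂ refl) =
        ≤-trans (positive-* (α-positive m) (positive m ≤-refl)) (m≤m+n _ _)

    vanishing′ : ∀ j → suc (suc m) < j → x′ j ≡ 0
    vanishing′ (suc j) (s≤s m+1<j) = zero-factor m (x′ (suc j)) (begin-equality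
      suc m * x′ (suc j)                  ≡⟨ recurrence j ⟩
      α m j * x j + β m j * x (suc j)     ≡⟨ cong₂ (λ u v → α m j * u + β m j * v)
                                               (vanishing j m+1<j) (vanishing (suc j) (m<n⇒m<1+n m+1<j)) ⟩
      α m j * 0 + β m j * 0               ≡⟨ cong₂ _+_ (*-zeroʳ (α m j)) (*-zeroʳ (β m j)) ⟩
      0                                   ∎)

    gain : ∀ s → s ≤ m →
      (suc m * x′ (1 + s)) * (suc m * x′ (3 + s)) + 4 * slack s (m ∸ s) * (x (1 + s) * x (1 + s))
        ≤ (suc m * x′ (2 + s)) * (suc m * x′ (2 + s))
    gain s s≤m = begin
      (suc m * x′ (1 + s)) * (suc m * x′ (3 + s)) + extra
        ≡⟨ cong (_+ extra) (cong₂ _*_ (recurrence s) (recurrence (2 + s))) ⟩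
      Y₁ m * Y₃ m + extra
        ≤⟨ subst (λ n → Y₁ n * Y₃ n + extra ≤ Y₂ n * Y₂ n) (m+[n∸m]≡n s≤m)
             (key-inequality s (m ∸ s) (x s) (x (1 + s)) (x (2 + s)) (x (3 + s))
               (log-concave s) (log-concave (1 + s)) (log-concave-gap s)) ⟩
      Y₂ m * Y₂ m
        ≡⟨ cong₂ _*_ (recurrence (1 + s)) (recurrence (1 + s)) ⟨
      (suc m * x′ (2 + s)) * (suc m * x′ (2 + s)) ∎
      where
      extra : ℕ
      extra = 4 * slack s (m ∸ s) * (x (1 + s) * x (1 + s))
      Y₁ Y₂ Y₃ : ℕ → ℕ
      Y₁ n = α n s * x s + β n s * x (1 + s)
      Y₂ n = α n (1 + s) * x (1 + s) + β n (1 + s) * x (2 + s)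
      Y₃ n = α n (2 + s) * x (2 + s) + β n (2 + s) * x (3 + s)

    strictly-log-concave′ : ∀ s → s ≤ m → x′ (1 + s) * x′ (3 + s) < x′ (2 + s) * x′ (2 + s)
    strictly-log-concave′ s s≤m = *-cancelˡ-< (suc m * suc m) _ _
      (subst₂ _<_ (square-factor (suc m) (x′ (1 + s)) (x′ (3 + s)))
                  (square-factor (suc m) (x′ (2 + s)) (x′ (2 + s)))
        (<-≤-trans (m<m+n _ extra>0) (gain s s≤m)))
      where
      extra>0 : 0 < 4 * slack s (m ∸ s) * (x (1 + s) * x (1 + s))
      extra>0 = positive-* (positive-* {4} (s≤s z≤n) (slack-positive s (m ∸ s))) (positive-* (positive s s≤m) (positive s s≤m))

    log-concave′ : ∀ n → x′ n * x′ (2 + n) ≤ x′ (1 + n) * x′ (1 + n)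
    log-concave′ zero    = subst (_≤ x′ 1 * x′ 1) (sym (cong (_* x′ 2) x′-zero)) z≤n
    log-concave′ (suc s) with s ≤? m
    ... | yes s≤m = <⇒≤ (strictly-log-concave′ s s≤m)
    ... | no  s≰m = subst (_≤ x′ (2 + s) * x′ (2 + s)) (sym x′₁x′₃≡0) z≤n
      where
      x′₁x′₃≡0 : x′ (1 + s) * x′ (3 + s) ≡ 0
      x′₁x′₃≡0 = trans (cong (x′ (1 + s) *_) (vanishing′ (3 + s) (s≤s (s≤s (s≤s (<⇒≤ (≰⇒> s≰m)))))))
                       (*-zeroʳ (x′ (1 + s)))

    admissible′ : Admissible (suc m) x′
    admissible′ = record { positive = positive′ ; vanishing = vanishing′ ; log-concave = log-concave′ }

module ScaledSequence where

  open import Data.Nat using (ℕ; zero; suc; _+_; _*_; _≤_; _<_; _!; z≤n; s≤s)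
  open import Data.Nat.Properties
  open import Relation.Binary.PropositionalEquality
  open import Data.Nat.Tactic.RingSolver using (solve-∀)
  open Recurrence
  open LogConcavity

  -- x_0(m) = 0 and x_{j+1}(m) = j! D_j(m): the sequence i! d_i(m), shifted by one and scaled by 4^m.
  scaled : ℕ → ℕ → ℕ
  scaled m zero    = 0
  scaled m (suc j) = j ! * D j m

  scaled-rec : ∀ m j → suc m * scaled (suc m) (suc j) ≡ α m j * scaled m j + β m j * scaled m (suc j)
  scaled-rec m zero = begin
    suc m * (1 * D 0 (suc m))  ≡⟨ cong (suc m *_) (*-identityˡ _) ⟩
    suc m * D 0 (suc m)        ≡⟨ D-rec-zero m ⟩
    (8 * m + 6) * D 0 m        ≡⟨ as-β m (D 0 m) ⟩
    α m 0 * 0 + β m 0 * (1 * D 0 m) ∎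
    where
    open ≡-Reasoning
    as-β : ∀ m x → (8 * m + 6) * x ≡ 4 * 0 * (m + 0) * 0 + 2 * (4 * m + 2 * 0 + 3) * (1 * x)
    as-β = solve-∀
  scaled-rec m (suc i) = begin
    suc m * (suc i ! * D (suc i) (suc m))
      ≡⟨ reorder m i (i !) (D (suc i) (suc m)) ⟩
    suc i * i ! * (suc m * D (suc i) (suc m))
      ≡⟨ cong (suc i * i ! *_) (D-rec m i) ⟩
    suc i * i ! * (4 * (m + i + 1) * D i m + (8 * m + 4 * i + 10) * D (suc i) m)
      ≡⟨ distribute m i (i !) (D i m) (D (suc i) m) ⟩
    α m (suc i) * (i ! * D i m) + β m (suc i) * (suc i ! * D (suc i) m) ∎
    where
    open ≡-Reasoning
    reorder : ∀ m i f x → suc m * (suc i * f * x) ≡ suc i * f * (suc m * x)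
    reorder = solve-∀
    distribute : ∀ m i f x y → suc i * f * (4 * (m + i + 1) * x + (8 * m + 4 * i + 10) * y)
      ≡ 4 * suc i * (m + suc i) * (f * x) + 2 * (4 * m + 2 * suc i + 3) * (suc i * f * y)
    distribute = solve-∀

  admissible : ∀ m → Admissible m (scaled m)
  admissible zero = record { positive = positive ; vanishing = vanishing ; log-concave = log-concave }
    where
    positive : ∀ j → j ≤ 0 → 0 < scaled 0 (suc j)
    positive zero _ = s≤s z≤n
    vanishing : ∀ j → 1 < j → scaled 0 j ≡ 0
    vanishing (suc zero)    (s≤s ())
    vanishing (suc (suc i)) _ = *-zeroʳ (suc i !)
    log-concave : ∀ n → scaled 0 n * scaled 0 (2 + n) ≤ scaled 0 (1 + n) * scaled 0 (1 + n)
    log-concave n = subst (_≤ scaled 0 (1 + n) * scaled 0 (1 + n))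
      (sym (trans (cong (scaled 0 n *_) (vanishing (2 + n) (s≤s (s≤s z≤n)))) (*-zeroʳ (scaled 0 n)))) z≤n
  admissible (suc m) = Step.admissible′ m (scaled m) (scaled (suc m)) (scaled-rec m) refl (admissible m)

  D-strict : ∀ m s → s ≤ m →
    (2 + s) * (D s (suc m) * D (2 + s) (suc m)) < (1 + s) * (D (1 + s) (suc m) * D (1 + s) (suc m))
  D-strict m s s≤m = *-cancelˡ-< ((1 + s) * (s ! * s !)) _ _
    (subst₂ _<_ (factor-left s (s !) (D s (suc m)) (D (2 + s) (suc m)))
                (factor-right s (s !) (D (1 + s) (suc m)))
      (Step.strictly-log-concave′ m (scaled m) (scaled (suc m)) (scaled-rec m) refl (admissible m) s s≤m))
    where
    factor-left : ∀ s f x z → f * x * ((2 + s) * ((1 + s) * f) * z) ≡ (1 + s) * (f * f) * ((2 + s) * (x * z))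
    factor-left = solve-∀
    factor-right : ∀ s f y → (1 + s) * f * y * ((1 + s) * f * y) ≡ (1 + s) * (f * f) * ((1 + s) * (y * y))
    factor-right = solve-∀

module RationalTransfer where

  open import Data.Nat as ℕ using (ℕ; suc; NonZero)
  open import Data.Integer as ℤ using (+_)
  open import Data.Rational using (_*_; _<_; _/_; toℚᵘ)
  open import Data.Rational.Properties using (toℚᵘ-cancel-<; toℚᵘ-homo-*; toℚᵘ-fromℚᵘ)
  open import Data.Rational.Unnormalised as ℚᵘ using (ℚᵘ; mkℚᵘ; _≃_)
  import Data.Rational.Unnormalised.Properties as ℚᵘ
  import Data.Integer.Properties as ℤ
  import Data.Nat.Properties as ℕ
  open import Relation.Binary.PropositionalEquality using (sym)

  triple : ℕ → ℕ → ℕ → ℕ → ℚᵘ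
  triple a b c n = mkℚᵘ (+ a) 0 ℚᵘ.* (mkℚᵘ (+ b) n ℚᵘ.* mkℚᵘ (+ c) n)

  toℚᵘ-triple : ∀ a b c n →
    toℚᵘ ((+ a / 1) * ((+ b / suc n) * (+ c / suc n))) ≃ triple a b c n
  toℚᵘ-triple a b c n =
    ℚᵘ.≃-trans (toℚᵘ-homo-* (+ a / 1) _)
      (ℚᵘ.*-cong (fraction a 0)
        (ℚᵘ.≃-trans (toℚᵘ-homo-* (+ b / suc n) _) (ℚᵘ.*-cong (fraction b n) (fraction c n))))
    where
    fraction : ∀ x n → toℚᵘ (+ x / suc n) ≃ mkℚᵘ (+ x) n
    fraction x n = toℚᵘ-fromℚᵘ (mkℚᵘ (+ x) n)

  -- Both sides share the denominator N², so the comparison is one of natural numerators.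
  triple-< : ∀ a b c e f g n → a ℕ.* (b ℕ.* c) ℕ.< e ℕ.* (f ℕ.* g) → triple a b c n ℚᵘ.< triple e f g n
  triple-< a b c e f g n lt = ℚᵘ.*<* numerators
    where
    N² : ℕ
    N² = 1 ℕ.* (suc n ℕ.* suc n)
    numerators : (+ a ℤ.* (+ b ℤ.* + c)) ℤ.* (+ N²) ℤ.< (+ e ℤ.* (+ f ℤ.* + g)) ℤ.* (+ N²)
    numerators rewrite sym (ℤ.pos-* b c) | sym (ℤ.pos-* f g)
                     | sym (ℤ.pos-* a (b ℕ.* c)) | sym (ℤ.pos-* e (f ℕ.* g))
                     | sym (ℤ.pos-* (a ℕ.* (b ℕ.* c)) N²) | sym (ℤ.pos-* (e ℕ.* (f ℕ.* g)) N²)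
                     = ℤ.+<+ (ℕ.*-monoˡ-< N² lt)

  scaled-product-< : ∀ a b c e f g N .{{_ : NonZero N}} → a ℕ.* (b ℕ.* c) ℕ.< e ℕ.* (f ℕ.* g) →
    (+ a / 1) * ((+ b / N) * (+ c / N)) < (+ e / 1) * ((+ f / N) * (+ g / N))
  scaled-product-< a b c e f g (suc n) lt = toℚᵘ-cancel-<
    (ℚᵘ.<-respˡ-≃ (ℚᵘ.≃-sym (toℚᵘ-triple a b c n))
      (ℚᵘ.<-respʳ-≃ (ℚᵘ.≃-sym (toℚᵘ-triple e f g n)) (triple-< a b c e f g n lt)))

open import Data.Nat using (ℕ; suc; _≤_; _∸_)
open import Data.Integer using (+_)
open import Data.Rational using (_*_; _<_; _/_)
import Data.Nat as ℕ
import Data.Nat.Properties as ℕ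
open import Relation.Binary.PropositionalEquality using (_≡_; cong₂; subst₂; sym)

-- With degree M = m+2 and i = s+1, the claim is (s+2) d_s d_{s+2} < (s+1) d_{s+1}², i.e. D-strict
-- after clearing the common denominator 4^M.
corollary4p1 : (m i : ℕ) → 2 ≤ m → 1 ≤ i → i ≤ m ∸ 1 →
    ((+ suc i) / 1) * (d (i ∸ 1) m * d (suc i) m) < ((+ i) / 1) * (d i m * d i m)
corollary4p1 (suc (suc m)) (suc s) _ _ (ℕ.s≤s s≤m) =
  RationalTransfer.scaled-product-< (2 ℕ.+ s) (dNum s M) (dNum (2 ℕ.+ s) M)
                                    (1 ℕ.+ s) (dNum (1 ℕ.+ s) M) (dNum (1 ℕ.+ s) M) (2 ℕ.^ (2 ℕ.* M))
    {{ℕ.>-nonZero (ℕ.m^n>0 2 (2 ℕ.* M))}}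
    (subst₂ ℕ._<_ (sym (in-numerators (2 ℕ.+ s) s (2 ℕ.+ s))) (sym (in-numerators (1 ℕ.+ s) (1 ℕ.+ s) (1 ℕ.+ s)))
      (ScaledSequence.D-strict (suc m) s (ℕ.m≤n⇒m≤1+n s≤m)))
  where
  M : ℕ
  M = suc (suc m)
  in-numerators : ∀ c i j → c ℕ.* (dNum i M ℕ.* dNum j M) ≡ c ℕ.* (Recurrence.D i M ℕ.* Recurrence.D j M)
  in-numerators c i j = cong₂ (λ x y → c ℕ.* (x ℕ.* y)) (Recurrence.dNum≡D i M) (Recurrence.dNum≡D j M)
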